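{- Let $n>k\ge1$, $\lambda,\mu\in P_{kn}$, $d\ge0$ an integer. The toric Schur polynomial $s_{\lambda/d/\mu}(x_1,\dots,x_k)$ is nonzero if and only if the shape $\lambda/d/\mu$ is toric.
   Context: $P_{kn}$ is the set of partitions $\lambda=(\lambda_1\ge\dots\ge\lambda_k\ge0)$ with $\lambda_1\le n-k$. $\mathcal{C}_{kn}=\mathbb{Z}^2/(-k,n-k)\mathbb{Z}$, $\langle i,j\rangle$ the class of $(i,j)$. For $\lambda\in P_{kn}$, $r\in\mathbb{Z}$, $\lambda[r]$ is the sequence with $\lambda[r]_{i+r}=\lambda_i+r$ ($i=1,\dots,k$) and $\lambda[r]_i=\lambda[r]_{i+k}+(n-k)$. The cylindric diagram of shape $\lambda/d/\mu$ is $D=\{\langle i,j\rangle:\mu[0]_i<j\le\lambda[d]_i\}\subset\mathcal{C}_{kn}$. The shape is toric if the projection $D\to\mathbb{Z}/k\mathbb{Z}\times\mathbb{Z}/(n-k)\mathbb{Z}$, $\langle i,j\rangle\mapsto(i\bmod k,j\bmod(n-k))$, is injective. A semi-standard cylindric tableau of shape $\lambda/d/\mu$ is $T:D\to\mathbb{Z}_{>0}$ with $T(\langle i,j\rangle)\le T(\langle i,j+1\rangle)$ and $T(\langle i,j\rangle)<T(\langle i+1,j\rangle)$ whenever both arguments lie in $D$; $\mathbf{x}^T=\prod_{a\in D}x_{T(a)}$. The cylindric Schur function is $s_{\lambda/d/\mu}(\mathbf{x})=\sum_T\mathbf{x}^T$ and the toric Schur polynomial $s_{\lambda/d/\mu}(x_1,\dots,x_k)$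 is its specialization at $x_{k+1}=x_{k+2}=\dots=0$. -}

module Defs where

open import Data.Nat as ℕ using (ℕ; zero; suc; NonZero; _∸_)
open import Data.Integer as ℤ using (ℤ; +_; -[1+_])
open import Data.Integer.DivMod using (_/ℕ_; _%ℕ_; n%ℕd<d)
open import Data.Integer.Divisibility using (_∣_)
open import Data.Fin as Fin using (Fin; fromℕ<; toℕ)
open import Data.Fin.Properties using () renaming (_≟_ to _≟F_)
open import Data.Vec as Vec using (Vec)
open import Data.Vec.Properties using (≡-dec)
open import Data.List as List using (List; []; _∷_)
open import Data.Bool.ListAction using (and)
open import Data.Nat.ListAction using (sum)
open import Data.Maybe using (Maybe; just; nothing)
open import Data.Bool using (Bool; true; false; _∧_; _∨_; not; T)
open import Data.Product using (Σ; _×_)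
open import Relation.Nullary using (¬_; does)
open import Relation.Nullary.Decidable using (T?)
open import Relation.Binary.PropositionalEquality using (_≡_)

-- A partition λ = (λ_1 ≥ … ≥ λ_k ≥ 0) is a function
-- lam : Fin k → ℕ with lam i = λ_{toℕ i + 1}.  All row/column indices
-- of ℤ² are integers, 1-based in rows exactly as in the paper.

-- λ ∈ P_{kn}: weakly decreasing, and λ_1 ≤ n - k (stated for every part,
-- which is the same since λ_1 is the largest part).
InP : (n k : ℕ) → (Fin k → ℕ) → Set
InP n k lam =
  ((i j : Fin k) → i Fin.≤ j → lam j ℕ.≤ lam i) × ((i : Fin k) → lam i ℕ.≤ n ∸ k)

-- The sequence λ[r] : ℤ → ℤ:  λ[r]_{i+r} = λ_i + r for i = 1..k and
-- λ[r]_i = λ[r]_{i+k} + (n-k).  Writing m - r - 1 = q k + s (0 ≤ s < k)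
-- this is λ[r]_m = λ_{s+1} + r - q (n-k).
shiftSeq : (n k : ℕ) {{_ : NonZero k}} → (Fin k → ℕ) → ℤ → ℤ → ℤ
shiftSeq n k lam r m =
  (+ lam (fromℕ< (n%ℕd<d t k)) ℤ.+ r) ℤ.- (t /ℕ k) ℤ.* + (n ∸ k)
  where t = m ℤ.- r ℤ.- ℤ.1ℤ

-- Membership of (the class of) (i , j) in the cylindric diagram of shape
-- λ/d/μ:  μ[0]_i < j ≤ λ[d]_i.  (Invariant under (i,j) ↦ (i-k, j+n-k).)
InD : (n k : ℕ) {{_ : NonZero k}} → (Fin k → ℕ) → ℕ → (Fin k → ℕ) → ℤ → ℤ → Set
InD n k lam d mu i j = (shiftSeq n k mu ℤ.0ℤ i ℤ.< j) × (j ℤ.≤ shiftSeq n k lam (+ d) i)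

inDᵇ : (n k : ℕ) {{_ : NonZero k}} → (Fin k → ℕ) → ℕ → (Fin k → ℕ) → ℤ → ℤ → Bool
inDᵇ n k lam d mu i j =
  does (shiftSeq n k mu ℤ.0ℤ i ℤ.<? j) ∧ does (j ℤ.≤? shiftSeq n k lam (+ d) i)

-- Toric shapes: the projection D → ℤ/k × ℤ/(n-k),
-- ⟨i,j⟩ ↦ (i mod k, j mod (n-k)) is injective, i.e. two cells of D with
-- the same image are the same element of C_{kn} = ℤ²/(-k,n-k)ℤ.

IsToric : (n k : ℕ) {{_ : NonZero k}} → (Fin k → ℕ) → ℕ → (Fin k → ℕ) → Set
IsToric n k lam d mu =
  (i j i' j' : ℤ) → InD n k lam d mu i j → InD n k lam d mu i' j' →
  (+ k) ∣ (i ℤ.- i') → (+ (n ∸ k)) ∣ (j ℤ.- j') →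
  Σ ℤ (λ q → (i' ≡ i ℤ.- q ℤ.* + k) × (j' ≡ j ℤ.+ q ℤ.* + (n ∸ k)))

-- Every class of C_{kn} has a unique representative ⟨i,j⟩ with 1 ≤ i ≤ k;
-- the cells of D in row i (1 ≤ i ≤ k) are ⟨i, μ[0]_i + 1 + t⟩ for
-- t < len i.  A filling of D with entries in {1,…,k} (the only tableaux
-- surviving the specialisation x_{k+1} = x_{k+2} = … = 0) is a list of k
-- rows, row i being a word of length len i over Fin k (entry e ↔ e+1).

clamp : ℤ → ℕ
clamp (+ m) = m
clamp -[1+ _ ] = 0

rowLo : (n k : ℕ) {{_ : NonZero k}} → (Fin k → ℕ) → ℤ → ℤ
rowLo n k mu i = shiftSeq n k mu ℤ.0ℤ i

rowLen : (n k : ℕ) {{_ : NonZero k}} → (Fin k → ℕ) → ℕ → (Fin k → ℕ) → ℤ → ℕ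
rowLen n k lam d mu i = clamp (shiftSeq n k lam (+ d) i ℤ.- rowLo n k mu i)

repRows : (k : ℕ) → List ℤ
repRows k = List.map (λ s → + suc s) (List.upTo k)

words : (k : ℕ) → ℕ → List (List (Fin k))
words k zero = [] ∷ []
words k (suc m) = List.concatMap (λ w → List.map (λ e → e ∷ w) (List.allFin k)) (words k m)

fillingsOf : (k : ℕ) → List ℕ → List (List (List (Fin k)))
fillingsOf k [] = [] ∷ []
fillingsOf k (l ∷ ls) = List.concatMap (λ f → List.map (λ w → w ∷ f) (words k l)) (fillingsOf k ls)

Filling : ℕ → Set
Filling k = List (List (Fin k))

allFillings : (n k : ℕ) {{_ : NonZero k}} → (Fin k → ℕ) → ℕ → (Fin k → ℕ) → List (Filling k)
allFillings n k lam d mu = fillingsOf k (List.map (rowLen n k lam d mu) (repRows k))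

nth : {A : Set} → List A → ℕ → Maybe A
nth [] _ = nothing
nth (x ∷ xs) zero = just x
nth (x ∷ xs) (suc m) = nth xs m

-- the entry T(⟨i,j⟩) ∈ {1,…,k} of a filling at an arbitrary (i,j) ∈ ℤ²
-- (via its representative ⟨i - qk, j + q(n-k)⟩ with 1 ≤ i - qk ≤ k);
-- 0 if the position carries no entry (only used on cells of D).
entry : (n k : ℕ) {{_ : NonZero k}} → (Fin k → ℕ) → Filling k → ℤ → ℤ → ℕ
entry n k mu F i j with nth F ((i ℤ.- ℤ.1ℤ) %ℕ k)
... | nothing = 0
... | just row with (j ℤ.+ ((i ℤ.- ℤ.1ℤ) /ℕ k) ℤ.* + (n ∸ k))
                     ℤ.- rowLo n k mu (+ suc ((i ℤ.- ℤ.1ℤ) %ℕ k)) ℤ.- ℤ.1ℤ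
...   | -[1+ _ ] = 0
...   | + t with nth row t
...     | nothing = 0
...     | just e = suc (toℕ e)

semistandardᵇ : (n k : ℕ) {{_ : NonZero k}} → (Fin k → ℕ) → ℕ → (Fin k → ℕ) → Filling k → Bool
semistandardᵇ n k lam d mu F =
  and (List.concatMap
    (λ i → List.map (λ t → cellOK i (rowLo n k mu i ℤ.+ ℤ.1ℤ ℤ.+ + t))
                    (List.upTo (rowLen n k lam d mu i)))
    (repRows k))
  where
  T' = entry n k mu F
  cellOK : ℤ → ℤ → Bool
  cellOK i j =
    (not (inDᵇ n k lam d mu i (j ℤ.+ ℤ.1ℤ)) ∨ (T' i j ℕ.≤ᵇ T' i (j ℤ.+ ℤ.1ℤ)))
    ∧ (not (inDᵇ n k lam d mu (i ℤ.+ ℤ.1ℤ) j) ∨ (T' i j ℕ.<ᵇ T' (i ℤ.+ ℤ.1ℤ) j))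

content : {k : ℕ} → Filling k → Vec ℕ k
content F = Vec.tabulate (λ e → sum (List.map (λ row → List.length (List.filter (e ≟F_) row)) F))

toricMonomials : (n k : ℕ) {{_ : NonZero k}} → (Fin k → ℕ) → ℕ → (Fin k → ℕ) → List (Vec ℕ k)
toricMonomials n k lam d mu =
  List.map content (List.filter (λ F → T? (semistandardᵇ n k lam d mu F)) (allFillings n k lam d mu))

-- s_{λ/d/μ}(x_1,…,x_k) ∈ ℕ[x_1,…,x_k], as its coefficient function:
-- coefficient of x^α = number of such tableaux T with x^T = x^α.
toricSchurCoeff : (n k : ℕ) {{_ : NonZero k}} → (Fin k → ℕ) → ℕ → (Fin k → ℕ) → Vec ℕ k → ℕ
toricSchurCoeff n k lam d mu α =
  List.length (List.filter (λ β → ≡-dec ℕ._≟_ β α) (toricMonomials n k lam d mu))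

ToricSchurNonzero : (n k : ℕ) {{_ : NonZero k}} → (Fin k → ℕ) → ℕ → (Fin k → ℕ) → Set
ToricSchurNonzero n k lam d mu = ¬ ((α : Vec ℕ k) → toricSchurCoeff n k lam d mu α ≡ 0)

module Submission where

-- If the shape is not toric, two cells of D in different classes have the
-- same image in ℤ/k × ℤ/(n-k); translating one of them along (-k , n-k) puts
-- both in one row at a distance that is a nonzero multiple of n-k, so some row
-- contains cells (i , x) and (i , x + n - k).  Since λ[d] and μ[0] are weakly
-- decreasing and λ[d]_{i+k} = λ[d]_i - (n-k), the k + 1 cells (i , x), …,
-- (i + k , x) then lie in D, and no semistandard filling with entries in
-- {1, …, k} can increase strictly down that column.
--
-- If the shape is toric, T⟨i,j⟩ = 1 + #{1 ≤ t < k : μ[0]_{i-t} < j} is a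
-- semistandard cylindric tableau with entries in {1, …, k}: it is weakly
-- increasing along rows, and down a column the count gains the term of row i
-- and loses that of row i + 1 - k, which vanishes because toricity forbids
-- ⟨i+1-k , j⟩ ∈ D when ⟨i+1 , j⟩ ∈ D.

open import Defs

module CylindricTableaux where

  open import Data.Bool using (Bool; true; false; T; _∧_; _∨_; not)
  import Data.Bool.Properties as BoolP
  open import Data.Bool.ListAction using (and)
  open import Data.Empty using (⊥-elim)
  open import Data.Fin as Fin using (Fin; fromℕ<; toℕ)
  import Data.Fin.Properties as FinP
  open import Data.Integer as ℤ using (ℤ; +_; -[1+_]; _+_; _*_; _-_; -_; _≤_; _<_; 0ℤ; 1ℤ)
  import Data.Integer.Properties as ℤP
  open import Data.Integer.DivMod using (_/ℕ_; _%ℕ_; n%ℕd<d; a≡a%ℕn+[a/ℕn]*n)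
  import Data.Integer.Divisibility.Signed as ℤD
  open import Data.Integer.Divisibility using (_∣_)
  open import Data.Integer.Tactic.RingSolver using (solve-∀)
  open import Data.List using (List; []; _∷_; map; concatMap; upTo; applyUpTo; length; allFin; filter)
  import Data.List.Properties as ListP
  open import Data.List.Membership.Propositional using (_∈_; find)
  open import Data.List.Membership.Propositional.Properties
    using (∈-allFin; ∈-concatMap⁺; ∈-concatMap⁻; ∈-filter⁺; ∈-map⁺; ∈-map⁻; ∈-upTo⁺; ∈-upTo⁻)
  open import Data.List.Relation.Unary.Any as Any using (here; there)
  import Data.List.Relation.Unary.All as All
  open import Data.Maybe using (Maybe; just; nothing)
  open import Data.Nat as ℕ using (ℕ; zero; suc; NonZero; _∸_)
  import Data.Nat.Properties as ℕP
  open import Data.Product using (∃₂; ∃-syntax; _×_; _,_; proj₁; proj₂)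
  open import Data.Sum using (_⊎_; inj₁; inj₂; [_,_]′)
  open import Data.Unit using (tt)
  import Data.Vec.Properties as VecP
  open import Function.Base using (_∘_)
  open import Function.Bundles using (_⇔_; mk⇔; Equivalence)
  open import Relation.Nullary using (Dec; yes; no; does; ¬_)
  open import Relation.Nullary.Decidable using (T?)
  open import Relation.Binary.PropositionalEquality

  i≤j⇒∃[o]j≡i+o : ∀ {i j} → i ≤ j → ∃[ o ] j ≡ i + + o
  i≤j⇒∃[o]j≡i+o {i} {j} i≤j = ℤ.∣ j - i ∣ , (begin
    j                  ≡⟨ j≡i+[j-i] i j ⟩
    i + (j - i)        ≡⟨ cong (_+_ i) (ℤP.0≤i⇒+∣i∣≡i (ℤP.i≤j⇒0≤j-i i≤j)) ⟨
    i + + ℤ.∣ j - i ∣  ∎)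
    where
    open ≡-Reasoning
    j≡i+[j-i] : ∀ i j → j ≡ i + (j - i)
    j≡i+[j-i] = solve-∀

  i<j⇒∃[o]j≡i+1+o : ∀ {i j} → i < j → ∃[ o ] j ≡ i + 1ℤ + + o
  i<j⇒∃[o]j≡i+1+o {i} i<j with i≤j⇒∃[o]j≡i+o (ℤP.i<j⇒suc[i]≤j i<j)
  ... | o , j≡1+i+o = o , trans j≡1+i+o (cong (_+ + o) (ℤP.+-comm 1ℤ i))

  i<i+1+o : ∀ i o → i < i + 1ℤ + + o
  i<i+1+o i o = ℤP.suc[i]≤j⇒i<j (subst (_≤ i + 1ℤ + + o) (ℤP.+-comm i 1ℤ) (ℤP.i≤i+j (i + 1ℤ) (+ o)))

  i-1≡s+qk⇒1+s≡i-qk : ∀ {i s} q kk → i - 1ℤ ≡ s + q * kk → 1ℤ + s ≡ i + (- q) * kk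
  i-1≡s+qk⇒1+s≡i-qk {i} {s} q kk i-1≡ = begin
    1ℤ + s                          ≡⟨ s≡ s q kk ⟩
    1ℤ + (s + q * kk) + (- q) * kk  ≡⟨ cong (λ x → 1ℤ + x + (- q) * kk) i-1≡ ⟨
    1ℤ + (i - 1ℤ) + (- q) * kk      ≡⟨ cong (_+ (- q) * kk) (i≡ i) ⟨
    i + (- q) * kk                  ∎
    where
    open ≡-Reasoning
    s≡ : ∀ s q kk → 1ℤ + s ≡ 1ℤ + (s + q * kk) + (- q) * kk
    s≡ = solve-∀
    i≡ : ∀ i → i ≡ 1ℤ + (i - 1ℤ)
    i≡ = solve-∀

  j+qn≡j-[-q]n : ∀ j q nn → j + q * nn ≡ j - (- q) * nn
  j+qn≡j-[-q]n = solve-∀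

  x-y≡[1+c]m⇒y+m≤x : ∀ {x y} c m → x - y ≡ + suc c * + m → y + + m ≤ x
  x-y≡[1+c]m⇒y+m≤x {x} {y} c m x-y≡ = subst (y + + m ≤_) x≡ (ℤP.i≤i+j (y + + m) (+ (c ℕ.* m)))
    where
    open ≡-Reasoning
    regroup : ∀ y c m → (y + m) + c * m ≡ y + (1ℤ + c) * m
    regroup = solve-∀
    y+[x-y] : ∀ x y → y + (x - y) ≡ x
    y+[x-y] = solve-∀
    x≡ : (y + + m) + + (c ℕ.* m) ≡ x
    x≡ = begin
      (y + + m) + + (c ℕ.* m)  ≡⟨ cong (_+_ (y + + m)) (ℤP.pos-* c m) ⟩
      (y + + m) + + c * + m    ≡⟨ regroup y (+ c) (+ m) ⟩
      y + + suc c * + m        ≡⟨ cong (_+_ y) x-y≡ ⟨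
      y + (x - y)              ≡⟨ y+[x-y] x y ⟩
      x                        ∎

  congruent-distinct⇒apart : ∀ {x y} c m → x - y ≡ c * + m → x ≢ y → (y + + m ≤ x) ⊎ (x + + m ≤ y)
  congruent-distinct⇒apart {x} {y} (+ zero) m x-y≡ x≢y = ⊥-elim (x≢y (ℤP.i-j≡0⇒i≡j x y x-y≡))
  congruent-distinct⇒apart (+ suc c) m x-y≡ _ = inj₁ (x-y≡[1+c]m⇒y+m≤x c m x-y≡)
  congruent-distinct⇒apart {x} {y} -[1+ c ] m x-y≡ _ = inj₂ (x-y≡[1+c]m⇒y+m≤x c m y-x≡)
    where
    y-x≡-[x-y] : ∀ x y → y - x ≡ - (x - y)
    y-x≡-[x-y] = solve-∀
    y-x≡ : y - x ≡ + suc c * + m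
    y-x≡ = trans (y-x≡-[x-y] x y) (trans (cong -_ x-y≡) (ℤP.neg-distribˡ-* -[1+ c ] (+ m)))

  module _ (k : ℕ) {{_ : NonZero k}} where

    divModℕ : ∀ z → ∃₂ λ s q → s ℕ.< k × z ≡ + s + q * + k
    divModℕ z = z %ℕ k , z /ℕ k , n%ℕd<d z k , a≡a%ℕn+[a/ℕn]*n z k

    s+x*k≡r⇒x≡0 : ∀ {s r} x → s ℕ.< k → r ℕ.< k → + s + x * + k ≡ + r → x ≡ 0ℤ
    s+x*k≡r⇒x≡0 (+ zero) _ _ _ = refl
    s+x*k≡r⇒x≡0 {s} {r} (+ suc y) _ r<k eq =
      ⊥-elim (ℕP.<⇒≱ r<k (subst (k ℕ.≤_) r≡ (ℕP.≤-trans (ℕP.m≤m+n k (y ℕ.* k)) (ℕP.m≤n+m _ s))))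
      where
      r≡ : s ℕ.+ (k ℕ.+ y ℕ.* k) ≡ r
      r≡ = ℤP.+-injective (trans (cong (_+_ (+ s)) (ℤP.pos-* (suc y) k)) eq)
    s+x*k≡r⇒x≡0 {s} {r} -[1+ y ] s<k _ eq =
      ⊥-elim (ℕP.<⇒≱ s<k (subst (k ℕ.≤_) (sym s≡) (ℕP.≤-trans (ℕP.m≤m+n k (y ℕ.* k)) (ℕP.m≤n+m _ r))))
      where
      s+[-a]k+ak : ∀ s a kk → s ≡ (s + (- a) * kk) + a * kk
      s+[-a]k+ak = solve-∀
      s≡ : s ≡ r ℕ.+ (k ℕ.+ y ℕ.* k)
      s≡ = ℤP.+-injective (begin
        + s                                ≡⟨ s+[-a]k+ak (+ s) (+ suc y) (+ k) ⟩
        (+ s + -[1+ y ] * + k) + + suc y * + k ≡⟨ cong (_+ + suc y * + k) eq ⟩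
        + r + + suc y * + k                ≡⟨ cong (_+_ (+ r)) (ℤP.pos-* (suc y) k) ⟨
        + (r ℕ.+ (k ℕ.+ y ℕ.* k))          ∎)
        where open ≡-Reasoning

    divModℕ-unique : ∀ {s} q → s ℕ.< k → (+ s + q * + k) %ℕ k ≡ s × (+ s + q * + k) /ℕ k ≡ q
    divModℕ-unique {s} q s<k = sym s≡r , sym q≡q′
      where
      open ≡-Reasoning
      z = + s + q * + k
      r = z %ℕ k
      q′ = z /ℕ k
      z≡r+q′k : z ≡ + r + q′ * + k
      z≡r+q′k = a≡a%ℕn+[a/ℕn]*n z k
      [s+qk]-q′k : ∀ s q q′ kk → s + (q - q′) * kk ≡ (s + q * kk) - q′ * kk
      [s+qk]-q′k = solve-∀
      [r+q′k]-q′k : ∀ r q′ kk → (r + q′ * kk) - q′ * kk ≡ r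
      [r+q′k]-q′k = solve-∀
      q≡q′ : q ≡ q′
      q≡q′ = ℤP.i-j≡0⇒i≡j q q′ (s+x*k≡r⇒x≡0 (q - q′) s<k (n%ℕd<d z k) (begin
        + s + (q - q′) * + k          ≡⟨ [s+qk]-q′k (+ s) q q′ (+ k) ⟩
        z - q′ * + k                  ≡⟨ cong (_- q′ * + k) z≡r+q′k ⟩
        (+ r + q′ * + k) - q′ * + k   ≡⟨ [r+q′k]-q′k (+ r) q′ (+ k) ⟩
        + r                           ∎))
      s≡r : s ≡ r
      s≡r = ℤP.+-injective (begin
        + s                           ≡⟨ [r+q′k]-q′k (+ s) q (+ k) ⟨
        z - q * + k                   ≡⟨ cong (λ x → z - x * + k) q≡q′ ⟩
        z - q′ * + k                  ≡⟨ cong (_- q′ * + k) z≡r+q′k ⟩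
        (+ r + q′ * + k) - q′ * + k   ≡⟨ [r+q′k]-q′k (+ r) q′ (+ k) ⟩
        + r                           ∎)

  -- The sequences λ[r]

  module Shift (n k : ℕ) {{_ : NonZero k}} where

    N : ℕ
    N = n ∸ k

    shiftSeq-normalForm : ∀ lam r m {s} q (s<k : s ℕ.< k) → m - r - 1ℤ ≡ + s + q * + k →
      shiftSeq n k lam r m ≡ (+ lam (fromℕ< s<k) + r) - q * + N
    shiftSeq-normalForm lam r m q s<k eq = go (m - r - 1ℤ) eq
      where
      go : ∀ t → t ≡ + _ + q * + k →
        (+ lam (fromℕ< (n%ℕd<d t k)) + r) - (t /ℕ k) * + N ≡ (+ lam (fromℕ< s<k) + r) - q * + N
      go t refl = cong₂ (λ i x → (+ lam i + r) - x * + N)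
        (FinP.fromℕ<-cong _ _ (proj₁ (divModℕ-unique k q s<k)) _ _)
        (proj₂ (divModℕ-unique k q s<k))

    shiftSeq-periodic : ∀ lam r m q → shiftSeq n k lam r (m + q * + k) ≡ shiftSeq n k lam r m - q * + N
    shiftSeq-periodic lam r m q with divModℕ k (m - r - 1ℤ)
    ... | s , q₀ , s<k , eq = begin
      shiftSeq n k lam r (m + q * + k)     ≡⟨ shiftSeq-normalForm lam r (m + q * + k) (q₀ + q) s<k eq′ ⟩
      (+ lam i + r) - (q₀ + q) * + N       ≡⟨ distrib (+ lam i + r) q₀ q (+ N) ⟩
      ((+ lam i + r) - q₀ * + N) - q * + N ≡⟨ cong (_- q * + N) (shiftSeq-normalForm lam r m q₀ s<k eq) ⟨
      shiftSeq n k lam r m - q * + N       ∎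
      where
      open ≡-Reasoning
      i = fromℕ< s<k
      distrib : ∀ a q₀ q nn → a - (q₀ + q) * nn ≡ (a - q₀ * nn) - q * nn
      distrib = solve-∀
      shifted : ∀ m r q kk → (m + q * kk) - r - 1ℤ ≡ (m - r - 1ℤ) + q * kk
      shifted = solve-∀
      regroup : ∀ s q₀ q kk → (s + q₀ * kk) + q * kk ≡ s + (q₀ + q) * kk
      regroup = solve-∀
      eq′ : (m + q * + k) - r - 1ℤ ≡ + s + (q₀ + q) * + k
      eq′ = trans (shifted m r q (+ k)) (trans (cong (_+ q * + k) eq) (regroup (+ s) q₀ q (+ k)))

    index-suc : ∀ m r s z → m - r - 1ℤ ≡ + s + z → (m + 1ℤ) - r - 1ℤ ≡ + suc s + z
    index-suc m r s z e = trans (succ m r) (trans (cong (_+_ 1ℤ) e) (sym (ℤP.+-assoc 1ℤ (+ s) z)))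
      where
      succ : ∀ m r → (m + 1ℤ) - r - 1ℤ ≡ 1ℤ + (m - r - 1ℤ)
      succ = solve-∀

    shiftSeq-step : ∀ lam → InP n k lam → ∀ r m → shiftSeq n k lam r (m + 1ℤ) ≤ shiftSeq n k lam r m
    shiftSeq-step lam (decreasing , bounded) r m with divModℕ k (m - r - 1ℤ)
    ... | s , q , s<k , eq with suc s ℕ.<? k
    ... | yes s+1<k = subst₂ _≤_
      (sym (shiftSeq-normalForm lam r (m + 1ℤ) q s+1<k (index-suc m r s (q * + k) eq)))
      (sym (shiftSeq-normalForm lam r m q s<k eq))
      (ℤP.+-monoˡ-≤ (- (q * + N)) (ℤP.+-monoˡ-≤ r (ℤ.+≤+ (decreasing _ _ s≤s+1))))
      where
      s≤s+1 : fromℕ< s<k Fin.≤ fromℕ< s+1<k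
      s≤s+1 = subst₂ ℕ._≤_ (sym (FinP.toℕ-fromℕ< s<k)) (sym (FinP.toℕ-fromℕ< s+1<k)) (ℕP.n≤1+n s)
    ... | no s+1≮k = subst₂ _≤_
      (sym (shiftSeq-normalForm lam r (m + 1ℤ) (q + 1ℤ) 0<k (wrap eq)))
      (sym (shiftSeq-normalForm lam r m q s<k eq))
      (subst₂ _≤_ (split-first (+ lam first) (+ N) r q) (split-last (+ lam last) r q (+ N))
        (ℤP.+-monoˡ-≤ (r - q * + N) (ℤP.≤-trans (ℤP.i≤j⇒i-j≤0 (ℤ.+≤+ (bounded first))) (ℤ.+≤+ ℕ.z≤n))))
      where
      open ≡-Reasoning
      0<k = ℕ.>-nonZero⁻¹ k
      first = fromℕ< 0<k
      last = fromℕ< s<k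
      s+1≡k : suc s ≡ k
      s+1≡k = ℕP.≤-antisym s<k (ℕP.≮⇒≥ s+1≮k)
      split-first : ∀ l nn r q → (l - nn) + (r - q * nn) ≡ (l + r) - (q + 1ℤ) * nn
      split-first = solve-∀
      split-last : ∀ l r q nn → l + (r - q * nn) ≡ (l + r) - q * nn
      split-last = solve-∀
      carry : ∀ q kk → kk + q * kk ≡ + 0 + (q + 1ℤ) * kk
      carry = solve-∀
      wrap : m - r - 1ℤ ≡ + s + q * + k → (m + 1ℤ) - r - 1ℤ ≡ + 0 + (q + 1ℤ) * + k
      wrap e = begin
        (m + 1ℤ) - r - 1ℤ   ≡⟨ index-suc m r s (q * + k) e ⟩
        + suc s + q * + k   ≡⟨ cong (λ x → + x + q * + k) s+1≡k ⟩
        + k + q * + k       ≡⟨ carry q (+ k) ⟩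
        + 0 + (q + 1ℤ) * + k ∎

    shiftSeq-antitone : ∀ lam → InP n k lam → ∀ r {m m′} → m ≤ m′ → shiftSeq n k lam r m′ ≤ shiftSeq n k lam r m
    shiftSeq-antitone lam ip r {m} m≤m′ with i≤j⇒∃[o]j≡i+o m≤m′
    ... | o , refl = go o
      where
      assoc : ∀ m o → (m + o) + 1ℤ ≡ m + (1ℤ + o)
      assoc = solve-∀
      go : ∀ o → shiftSeq n k lam r (m + + o) ≤ shiftSeq n k lam r m
      go zero = ℤP.≤-reflexive (cong (shiftSeq n k lam r) (ℤP.+-identityʳ m))
      go (suc o) = ℤP.≤-trans
        (subst (λ x → shiftSeq n k lam r x ≤ shiftSeq n k lam r (m + + o)) (assoc m (+ o)) (shiftSeq-step lam ip r (m + + o)))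
        (go o)

  module _ {A : Set} where

    nth-<length : ∀ (xs : List A) {t} → t ℕ.< length xs → ∃[ a ] nth xs t ≡ just a
    nth-<length (x ∷ xs) {zero} _ = x , refl
    nth-<length (x ∷ xs) {suc t} (ℕ.s≤s t<len) = nth-<length xs t<len

    nth-applyUpTo : ∀ (f : ℕ → A) {m s} → s ℕ.< m → nth (applyUpTo f m) s ≡ just (f s)
    nth-applyUpTo f {suc m} {zero} _ = refl
    nth-applyUpTo f {suc m} {suc s} (ℕ.s≤s s<m) = nth-applyUpTo (f ∘ suc) s<m

    nth-map : ∀ {B : Set} (f : A → B) xs {s a} → nth xs s ≡ just a → nth (map f xs) s ≡ just (f a)
    nth-map f (x ∷ xs) {zero} refl = refl
    nth-map f (x ∷ xs) {suc s} eq = nth-map f xs eq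

  nth-map-upTo : ∀ {A : Set} (f : ℕ → A) {m s} → s ℕ.< m → nth (map f (upTo m)) s ≡ just (f s)
  nth-map-upTo f {m} s<m = nth-map f (upTo m) (nth-applyUpTo (λ s → s) s<m)

  T-and⁻ : ∀ {b bs} → T (and bs) → b ∈ bs → T b
  T-and⁻ {bs = b ∷ _} all-true (here refl) = proj₁ (Equivalence.to BoolP.T-∧ all-true)
  T-and⁻ {bs = b ∷ _} all-true (there b∈bs) = T-and⁻ (proj₂ (Equivalence.to (BoolP.T-∧ {b}) all-true)) b∈bs

  T-and⁺ : ∀ bs → (∀ {b} → b ∈ bs → T b) → T (and bs)
  T-and⁺ [] _ = tt
  T-and⁺ (b ∷ bs) all-true = Equivalence.from BoolP.T-∧ (all-true (here refl) , T-and⁺ bs (all-true ∘ there))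

  T-not∨ : ∀ a {b} → T (not a ∨ b) ⇔ (T a → T b)
  T-not∨ true = mk⇔ (λ b _ → b) (λ a⇒b → a⇒b tt)
  T-not∨ false = mk⇔ (λ _ ()) (λ _ → tt)

  T-does : ∀ {P : Set} (p? : Dec P) → T (does p?) ⇔ P
  T-does (yes p) = mk⇔ (λ _ → p) (λ _ → tt)
  T-does (no ¬p) = mk⇔ (λ ()) ¬p

  words-length : ∀ k l {w} → w ∈ words k l → length w ≡ l
  words-length k zero (here refl) = refl
  words-length k (suc l) w∈ with find (∈-concatMap⁻ (λ v → map (_∷ v) (allFin k)) {xs = words k l} w∈)
  ... | v , v∈ , w∈map with ∈-map⁻ (_∷ v) w∈map
  ... | e , _ , refl = cong suc (words-length k l v∈)

  ∈-words : ∀ k (w : List (Fin k)) → w ∈ words k (length w)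
  ∈-words k [] = here refl
  ∈-words k (e ∷ w) =
    ∈-concatMap⁺ (λ v → map (_∷ v) (allFin k)) (Any.map (λ { refl → ∈-map⁺ (_∷ w) (∈-allFin e) }) (∈-words k w))

  ∈-fillingsOf-∷⁻ : ∀ {k l ls F} → F ∈ fillingsOf k (l ∷ ls) →
    ∃₂ λ w G → F ≡ w ∷ G × w ∈ words k l × G ∈ fillingsOf k ls
  ∈-fillingsOf-∷⁻ {k} {l} {ls} F∈ with find (∈-concatMap⁻ (λ G → map (_∷ G) (words k l)) {xs = fillingsOf k ls} F∈)
  ... | G , G∈ , F∈map with ∈-map⁻ (_∷ G) F∈map
  ... | w , w∈ , refl = w , G , refl , w∈ , G∈

  fillingsOf-rowLength : ∀ {k} ls {F} → F ∈ fillingsOf k ls → ∀ {s l} → nth ls s ≡ just l →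
    ∃[ w ] nth F s ≡ just w × length w ≡ l
  fillingsOf-rowLength {k} (l₀ ∷ ls) F∈ {s} eq with ∈-fillingsOf-∷⁻ {k} {l₀} {ls} F∈
  fillingsOf-rowLength {k} (l₀ ∷ ls) F∈ {zero} refl | w , G , refl , w∈ , _ = w , refl , words-length k l₀ w∈
  fillingsOf-rowLength {k} (l₀ ∷ ls) F∈ {suc s} eq | w , G , refl , _ , G∈ = fillingsOf-rowLength ls G∈ eq

  ∈-fillingsOf : ∀ {k} (F : Filling k) → F ∈ fillingsOf k (map length F)
  ∈-fillingsOf {k} [] = here refl
  ∈-fillingsOf {k} (w ∷ F) =
    ∈-concatMap⁺ (λ G → map (_∷ G) (words k (length w)))
      (Any.map (λ { refl → ∈-map⁺ (_∷ F) (∈-words k w) }) (∈-fillingsOf F))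

  -- The cylindric diagram

  module Diagram (n k : ℕ) {{_ : NonZero k}} (lam : Fin k → ℕ) (d : ℕ) (mu : Fin k → ℕ) where
    open Shift n k public

    lo hi : ℤ → ℤ
    lo = rowLo n k mu
    hi = shiftSeq n k lam (+ d)

    len : ℤ → ℕ
    len = rowLen n k lam d mu

    Cell : ℤ → ℤ → Set
    Cell = InD n k lam d mu

    Cell-translate : ∀ q {i j i′ j′} → i′ ≡ i + q * + k → j′ ≡ j - q * + N → Cell i j → Cell i′ j′
    Cell-translate q {i} {j} refl refl (lo<j , j≤hi) =
      subst (_< j - q * + N) (sym (shiftSeq-periodic mu 0ℤ i q)) (ℤP.+-monoˡ-< (- (q * + N)) lo<j) ,
      subst (j - q * + N ≤_) (sym (shiftSeq-periodic lam (+ d) i q)) (ℤP.+-monoˡ-≤ (- (q * + N)) j≤hi)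

    Cell⇒offset : ∀ {i j} → Cell i j → ∃[ t ] t ℕ.< len i × j ≡ lo i + 1ℤ + + t
    Cell⇒offset {i} {j} (lo<j , j≤hi) with i<j⇒∃[o]j≡i+1+o lo<j | i≤j⇒∃[o]j≡i+o j≤hi
    ... | t , j≡ | u , hi≡ = t , subst (λ x → t ℕ.< clamp x) (sym hi-lo) (ℕ.s≤s (ℕP.m≤m+n t u)) , j≡
      where
      open ≡-Reasoning
      cancel : ∀ l t u → ((l + 1ℤ + t) + u) - l ≡ 1ℤ + (t + u)
      cancel = solve-∀
      hi-lo : hi i - lo i ≡ + suc (t ℕ.+ u)
      hi-lo = begin
        hi i - lo i                          ≡⟨ cong (_- lo i) (trans hi≡ (cong (_+ + u) j≡)) ⟩
        ((lo i + 1ℤ + + t) + + u) - lo i     ≡⟨ cancel (lo i) (+ t) (+ u) ⟩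
        1ℤ + (+ t + + u)                     ≡⟨ cong (_+_ 1ℤ) (ℤP.pos-+ t u) ⟨
        + suc (t ℕ.+ u)                      ∎

    offset⇒Cell : ∀ i {t} → t ℕ.< len i → Cell i (lo i + 1ℤ + + t)
    offset⇒Cell i {t} t<len with hi i - lo i in hi-lo
    ... | + c with ℕP.m≤n⇒∃[o]m+o≡n t<len
    ...   | e , t+1+e≡c = i<i+1+o (lo i) t , subst (lo i + 1ℤ + + t ≤_) hi≡ (ℤP.i≤i+j _ (+ e))
      where
      open ≡-Reasoning
      regroup : ∀ l t e → l + 1ℤ + t + e ≡ l + ((1ℤ + t) + e)
      regroup = solve-∀
      l+[h-l] : ∀ l h → l + (h - l) ≡ h
      l+[h-l] = solve-∀
      hi≡ : lo i + 1ℤ + + t + + e ≡ hi i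
      hi≡ = begin
        lo i + 1ℤ + + t + + e     ≡⟨ regroup (lo i) (+ t) (+ e) ⟩
        lo i + + (suc t ℕ.+ e)    ≡⟨ cong (λ x → lo i + + x) t+1+e≡c ⟩
        lo i + + c                ≡⟨ cong (_+_ (lo i)) hi-lo ⟨
        lo i + (hi i - lo i)      ≡⟨ l+[h-l] (lo i) (hi i) ⟩
        hi i                      ∎
    offset⇒Cell i {t} () | -[1+ _ ]

    -- (1 + row , j + shift * N) is the representative of the class of (i , j)
    -- with first coordinate in 1..k, and it is the cell number offset of its
    -- row in the enumeration of D used by allFillings and semistandardᵇ.
    record Representative (i j : ℤ) : Set where
      field
        row : ℕ
        row<k : row ℕ.< k
        shift : ℤ
        offset : ℕ
        row≡ : i - 1ℤ ≡ + row + shift * + k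
        offset<len : offset ℕ.< len (+ suc row)
        col≡ : j + shift * + N ≡ lo (+ suc row) + 1ℤ + + offset

    representative : ∀ {i j} → Cell i j → Representative i j
    representative {i} {j} ij∈D with divModℕ k (i - 1ℤ)
    ... | s , q , s<k , i-1≡
      with Cell⇒offset {+ suc s}
             (Cell-translate (- q) {i} {j} (i-1≡s+qk⇒1+s≡i-qk {i} {+ s} q (+ k) i-1≡) (j+qn≡j-[-q]n j q (+ N)) ij∈D)
    ... | t , t<len , j≡ = record
      { row = s ; row<k = s<k ; shift = q ; offset = t ; row≡ = i-1≡ ; offset<len = t<len ; col≡ = j≡ }

  entryInRow : ∀ {k} → Maybe (List (Fin k)) → ℤ → ℕ
  entryInRow nothing _ = 0
  entryInRow (just row) -[1+ _ ] = 0
  entryInRow (just row) (+ t) with nth row t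
  ... | nothing = 0
  ... | just e = suc (toℕ e)

  entryInRow≤k : ∀ {k} row p → entryInRow {k} row p ℕ.≤ k
  entryInRow≤k nothing _ = ℕ.z≤n
  entryInRow≤k (just row) -[1+ _ ] = ℕ.z≤n
  entryInRow≤k (just row) (+ t) with nth row t
  ... | nothing = ℕ.z≤n
  ... | just e = FinP.toℕ<n e

  entryInRow-just : ∀ {k} (w : List (Fin k)) {t e} → nth w t ≡ just e → entryInRow (just w) (+ t) ≡ suc (toℕ e)
  entryInRow-just w {t} eq with nth w t
  entryInRow-just w refl | just _ = refl

  module Tableaux (n k : ℕ) {{_ : NonZero k}} (lam : Fin k → ℕ) (d : ℕ) (mu : Fin k → ℕ) where
    open Diagram n k lam d mu public

    entry-unfold : ∀ F i j → entry n k mu F i j ≡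
      entryInRow (nth F ((i - 1ℤ) %ℕ k)) ((j + ((i - 1ℤ) /ℕ k) * + N) - lo (+ suc ((i - 1ℤ) %ℕ k)) - 1ℤ)
    entry-unfold F i j with nth F ((i - 1ℤ) %ℕ k)
    ... | nothing = refl
    ... | just row with (j + ((i - 1ℤ) /ℕ k) * + N) - lo (+ suc ((i - 1ℤ) %ℕ k)) - 1ℤ
    ...   | -[1+ _ ] = refl
    ...   | + t with nth row t
    ...     | nothing = refl
    ...     | just e = refl

    entry-normalForm : ∀ F i j {s} q → s ℕ.< k → i - 1ℤ ≡ + s + q * + k →
      entry n k mu F i j ≡ entryInRow (nth F s) ((j + q * + N) - lo (+ suc s) - 1ℤ)
    entry-normalForm F i j {s} q s<k eq = trans (entry-unfold F i j) (go (i - 1ℤ) eq)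
      where
      go : ∀ x → x ≡ + s + q * + k →
        entryInRow (nth F (x %ℕ k)) ((j + (x /ℕ k) * + N) - lo (+ suc (x %ℕ k)) - 1ℤ) ≡
        entryInRow (nth F s) ((j + q * + N) - lo (+ suc s) - 1ℤ)
      go x refl rewrite divModℕ-unique k q s<k .proj₁ | divModℕ-unique k q s<k .proj₂ = refl

    entry-translate : ∀ F q {i j i′ j′} → i′ ≡ i + q * + k → j′ ≡ j - q * + N →
      entry n k mu F i′ j′ ≡ entry n k mu F i j
    entry-translate F q {i} {j} refl refl with divModℕ k (i - 1ℤ)
    ... | s , q₀ , s<k , i-1≡ = begin
      entry n k mu F (i + q * + k) (j - q * + N)
        ≡⟨ entry-normalForm F (i + q * + k) (j - q * + N) (q₀ + q) s<k (shifted i q (+ k) (+ s) q₀ i-1≡) ⟩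
      entryInRow (nth F s) (((j - q * + N) + (q₀ + q) * + N) - lo (+ suc s) - 1ℤ)
        ≡⟨ cong (λ x → entryInRow (nth F s) (x - lo (+ suc s) - 1ℤ)) (cancel j q q₀ (+ N)) ⟩
      entryInRow (nth F s) ((j + q₀ * + N) - lo (+ suc s) - 1ℤ)
        ≡⟨ entry-normalForm F i j q₀ s<k i-1≡ ⟨
      entry n k mu F i j ∎
      where
      open ≡-Reasoning
      cancel : ∀ j q q₀ nn → (j - q * nn) + (q₀ + q) * nn ≡ j + q₀ * nn
      cancel = solve-∀
      shift-sum : ∀ i q kk → (i + q * kk) - 1ℤ ≡ (i - 1ℤ) + q * kk
      shift-sum = solve-∀
      regroup : ∀ s q₀ q kk → (s + q₀ * kk) + q * kk ≡ s + (q₀ + q) * kk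
      regroup = solve-∀
      shifted : ∀ i q kk s q₀ → i - 1ℤ ≡ s + q₀ * kk → (i + q * kk) - 1ℤ ≡ s + (q₀ + q) * kk
      shifted i q kk s q₀ e = trans (shift-sum i q kk) (trans (cong (_+ q * kk) e) (regroup s q₀ q kk))

    entry-representative : ∀ F {i j} (r : Representative i j) →
      entry n k mu F i j ≡ entryInRow (nth F (Representative.row r)) (+ Representative.offset r)
    entry-representative F {i} {j} r = trans (entry-normalForm F i j shift row<k row≡)
      (cong (entryInRow (nth F row)) (offset≡ (lo (+ suc row)) (+ offset) col≡))
      where
      open Representative r
      offset≡ : ∀ l t {x} → x ≡ l + 1ℤ + t → x - l - 1ℤ ≡ t
      offset≡ l t refl = cancel l t
        where
        cancel : ∀ l t → (l + 1ℤ + t) - l - 1ℤ ≡ t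
        cancel = solve-∀

    entry≤k : ∀ F i j → entry n k mu F i j ℕ.≤ k
    entry≤k F i j = subst (ℕ._≤ k) (sym (entry-unfold F i j)) (entryInRow≤k (nth F ((i - 1ℤ) %ℕ k)) _)

    entry-positive : ∀ {F} → F ∈ allFillings n k lam d mu → ∀ {i j} → Cell i j → 0 ℕ.< entry n k mu F i j
    entry-positive {F} F∈ {i} {j} ij∈D = subst (0 ℕ.<_) (sym entry≡) ℕ.z<s
      where
      r = representative {i} {j} ij∈D
      open Representative r
      len-at-row : nth (map len (repRows k)) row ≡ just (len (+ suc row))
      len-at-row = nth-map len (repRows k) (nth-map-upTo (λ s → + suc s) row<k)
      rowF = fillingsOf-rowLength (map len (repRows k)) F∈ len-at-row
      w = proj₁ rowF
      cellF = nth-<length w (subst (offset ℕ.<_) (sym (proj₂ (proj₂ rowF))) offset<len)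
      entry≡ : entry n k mu F i j ≡ suc (toℕ (proj₁ cellF))
      entry≡ = trans (entry-representative F r)
        (trans (cong (λ x → entryInRow x (+ offset)) (proj₁ (proj₂ rowF))) (entryInRow-just w (proj₂ cellF)))

  module SemistandardTest (n k : ℕ) {{_ : NonZero k}} (lam : Fin k → ℕ) (d : ℕ) (mu : Fin k → ℕ) where
    open Tableaux n k lam d mu public
    open Equivalence

    RowWeak ColumnStrict : Filling k → ℤ → ℤ → Set
    RowWeak F i j = Cell i (j + 1ℤ) → entry n k mu F i j ℕ.≤ entry n k mu F i (j + 1ℤ)
    ColumnStrict F i j = Cell (i + 1ℤ) j → entry n k mu F i j ℕ.< entry n k mu F (i + 1ℤ) j

    Semistandard : Filling k → Set
    Semistandard F = ∀ {i j} → Cell i j → RowWeak F i j × ColumnStrict F i j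

    T-inDᵇ : ∀ i j → T (inDᵇ n k lam d mu i j) ⇔ Cell i j
    T-inDᵇ i j = mk⇔
      (λ t → let (lo<j , j≤hi) = to BoolP.T-∧ t in to (T-does (lo i ℤ.<? j)) lo<j , to (T-does (j ℤ.≤? hi i)) j≤hi)
      (λ (lo<j , j≤hi) → from BoolP.T-∧ (from (T-does (lo i ℤ.<? j)) lo<j , from (T-does (j ℤ.≤? hi i)) j≤hi))

    -- The test that semistandardᵇ applies to each cell (local to its definition).
    cellOKᵇ : Filling k → ℤ → ℤ → Bool
    cellOKᵇ F i j =
      (not (inDᵇ n k lam d mu i (j + 1ℤ)) ∨ (entry n k mu F i j ℕ.≤ᵇ entry n k mu F i (j + 1ℤ)))
      ∧ (not (inDᵇ n k lam d mu (i + 1ℤ) j) ∨ (entry n k mu F i j ℕ.<ᵇ entry n k mu F (i + 1ℤ) j))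

    T-cellOKᵇ : ∀ F i j → T (cellOKᵇ F i j) ⇔ (RowWeak F i j × ColumnStrict F i j)
    T-cellOKᵇ F i j = mk⇔
      (λ t → let (row , col) = to BoolP.T-∧ t in
        (λ c → ℕP.≤ᵇ⇒≤ _ _ (to (T-not∨ (inDᵇ n k lam d mu i (j + 1ℤ))) row (from (T-inDᵇ i (j + 1ℤ)) c))) ,
        (λ c → ℕP.<ᵇ⇒< _ _ (to (T-not∨ (inDᵇ n k lam d mu (i + 1ℤ) j)) col (from (T-inDᵇ (i + 1ℤ) j) c))))
      (λ (row , col) → from BoolP.T-∧
        ( from (T-not∨ (inDᵇ n k lam d mu i (j + 1ℤ))) (λ c → ℕP.≤⇒≤ᵇ (row (to (T-inDᵇ i (j + 1ℤ)) c)))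
        , from (T-not∨ (inDᵇ n k lam d mu (i + 1ℤ) j)) (λ c → ℕP.<⇒<ᵇ (col (to (T-inDᵇ (i + 1ℤ) j) c)))))

    RepresentativeCellsOK : Filling k → Set
    RepresentativeCellsOK F = ∀ {s t} → s ℕ.< k → t ℕ.< len (+ suc s) →
      RowWeak F (+ suc s) (lo (+ suc s) + 1ℤ + + t) × ColumnStrict F (+ suc s) (lo (+ suc s) + 1ℤ + + t)

    T-semistandardᵇ : ∀ F → T (semistandardᵇ n k lam d mu F) ⇔ RepresentativeCellsOK F
    T-semistandardᵇ F = mk⇔ sound complete
      where
      row : ℤ → List Bool
      row i = map (λ t → cellOKᵇ F i (lo i + 1ℤ + + t)) (upTo (len i))
      cells : List Bool
      cells = concatMap row (repRows k)
      cell∈ : ∀ {s t} → s ℕ.< k → t ℕ.< len (+ suc s) → cellOKᵇ F (+ suc s) (lo (+ suc s) + 1ℤ + + t) ∈ cells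
      cell∈ s<k t<len =
        ∈-concatMap⁺ row (Any.map (λ { refl → ∈-map⁺ _ (∈-upTo⁺ t<len) }) (∈-map⁺ _ (∈-upTo⁺ s<k)))
      T-cell : ∀ {b} → b ∈ cells → RepresentativeCellsOK F → T b
      T-cell b∈ ok with find (∈-concatMap⁻ row {xs = repRows k} b∈)
      ... | i , i∈ , b∈row with ∈-map⁻ (λ s → + suc s) i∈
      ... | s , s∈ , refl with ∈-map⁻ _ b∈row
      ... | t , t∈ , refl = from (T-cellOKᵇ F _ _) (ok (∈-upTo⁻ s∈) (∈-upTo⁻ t∈))
      sound : T (semistandardᵇ n k lam d mu F) → RepresentativeCellsOK F
      sound t s<k t<len = to (T-cellOKᵇ F _ _) (T-and⁻ t (cell∈ s<k t<len))
      complete : RepresentativeCellsOK F → T (semistandardᵇ n k lam d mu F)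
      complete ok = T-and⁺ cells (λ b∈ → T-cell b∈ ok)

    Semistandard⇒semistandardᵇ : ∀ F → Semistandard F → T (semistandardᵇ n k lam d mu F)
    Semistandard⇒semistandardᵇ F ss = from (T-semistandardᵇ F) (λ _ t<len → ss (offset⇒Cell (+ suc _) t<len))

    semistandardᵇ⇒ColumnStrict : ∀ F → T (semistandardᵇ n k lam d mu F) → ∀ {i j} → Cell i j → ColumnStrict F i j
    semistandardᵇ⇒ColumnStrict F ss {i} {j} ij∈D i+1j∈D = subst₂ ℕ._<_
      (entry-translate F (- shift) i≡ j≡)
      (entry-translate F (- shift) i+1≡ j≡)
      (proj₂ (to (T-semistandardᵇ F) ss row<k offset<len) (Cell-translate (- shift) {i + 1ℤ} {j} i+1≡ j≡ i+1j∈D))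
      where
      open Representative (representative {i} {j} ij∈D)
      i≡ : + suc row ≡ i + (- shift) * + k
      i≡ = i-1≡s+qk⇒1+s≡i-qk {i} {+ row} shift (+ k) row≡
      i+1≡ : + suc row + 1ℤ ≡ (i + 1ℤ) + (- shift) * + k
      i+1≡ = trans (cong (_+ 1ℤ) i≡) (swap i ((- shift) * + k))
        where
        swap : ∀ i x → (i + x) + 1ℤ ≡ (i + 1ℤ) + x
        swap = solve-∀
      j≡ : lo (+ suc row) + 1ℤ + + offset ≡ j - (- shift) * + N
      j≡ = trans (sym col≡) (j+qn≡j-[-q]n j shift (+ N))

  module _ (n k : ℕ) {{_ : NonZero k}} (lam : Fin k → ℕ) (d : ℕ) (mu : Fin k → ℕ) where

    SemistandardFilling : Set
    SemistandardFilling = ∃[ F ] F ∈ allFillings n k lam d mu × T (semistandardᵇ n k lam d mu F)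

    ¬SemistandardFilling⇒coeff≡0 : ¬ SemistandardFilling → ∀ α → toricSchurCoeff n k lam d mu α ≡ 0
    ¬SemistandardFilling⇒coeff≡0 none α =
      cong (λ Fs → length (filter (λ β → VecP.≡-dec ℕ._≟_ β α) (map content Fs)))
        (ListP.filter-none (λ F → T? (semistandardᵇ n k lam d mu F)) (All.tabulate (λ F∈ ss → none (_ , F∈ , ss))))

    SemistandardFilling⇒nonzero : SemistandardFilling → ToricSchurNonzero n k lam d mu
    SemistandardFilling⇒nonzero (F , F∈ , ss) all≡0 = ∈⇒length≢0 counted (all≡0 (content F))
      where
      ∈⇒length≢0 : ∀ {A : Set} {x : A} {xs} → x ∈ xs → length xs ≢ 0
      ∈⇒length≢0 (here _) ()
      ∈⇒length≢0 (there _) ()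
      counted = ∈-filter⁺ (λ β → VecP.≡-dec ℕ._≟_ β (content F))
        (∈-map⁺ content (∈-filter⁺ (λ F → T? (semistandardᵇ n k lam d mu F)) F∈ ss)) refl

  -- Non-toric shapes

  module NonToric (n k : ℕ) {{_ : NonZero k}} (lam mu : Fin k → ℕ) (ipL : InP n k lam) (ipM : InP n k mu) (d : ℕ) where
    open SemistandardTest n k lam d mu

    column-in-D : ∀ i x → lo i < x → x + + N ≤ hi i → ∀ t → t ℕ.≤ k → Cell (i + + t) x
    column-in-D i x lo<x x+N≤hi t t≤k =
      ℤP.≤-<-trans (shiftSeq-antitone mu ipM 0ℤ (ℤP.i≤i+j i (+ t))) lo<x ,
      ℤP.≤-trans x≤hi[i+k] (shiftSeq-antitone lam ipL (+ d) (ℤP.+-monoʳ-≤ i (ℤ.+≤+ t≤k)))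
      where
      cancel : ∀ x nn → (x + nn) - 1ℤ * nn ≡ x
      cancel = solve-∀
      hi[i+k] : hi (i + + k) ≡ hi i - 1ℤ * + N
      hi[i+k] = trans (cong (λ kk → hi (i + kk)) (sym (ℤP.*-identityˡ (+ k)))) (shiftSeq-periodic lam (+ d) i 1ℤ)
      x≤hi[i+k] : x ≤ hi (i + + k)
      x≤hi[i+k] = subst₂ _≤_ (cancel x (+ N)) (sym hi[i+k]) (ℤP.+-monoˡ-≤ (- (1ℤ * + N)) x+N≤hi)

    tall-column⇒¬semistandard : ∀ i x → lo i < x → x + + N ≤ hi i →
      ∀ {F} → F ∈ allFillings n k lam d mu → ¬ T (semistandardᵇ n k lam d mu F)
    tall-column⇒¬semistandard i x lo<x x+N≤hi {F} F∈ ss =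
      ℕP.<⇒≱ (bound k ℕP.≤-refl) (entry≤k F (i + + k) x)
      where
      next-row : ∀ t → (i + + t) + 1ℤ ≡ i + + suc t
      next-row t = assoc i (+ t)
        where
        assoc : ∀ i t → (i + t) + 1ℤ ≡ i + (1ℤ + t)
        assoc = solve-∀
      bound : ∀ t → t ℕ.≤ k → t ℕ.< entry n k mu F (i + + t) x
      bound zero _ = entry-positive F∈ {i + + 0} {x} (column-in-D i x lo<x x+N≤hi 0 ℕ.z≤n)
      bound (suc t) t<k = ℕP.<-≤-trans (ℕ.s≤s (bound t (ℕP.<⇒≤ t<k)))
        (subst (λ r → suc (entry n k mu F (i + + t) x) ℕ.≤ entry n k mu F r x) (next-row t)
          (semistandardᵇ⇒ColumnStrict F ss {i + + t} {x} (column-in-D i x lo<x x+N≤hi t (ℕP.<⇒≤ t<k))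
            (subst (λ r → Cell r x) (sym (next-row t)) (column-in-D i x lo<x x+N≤hi (suc t) t<k))))

    long-row⇒¬SemistandardFilling : ∀ i x x′ → Cell i x → Cell i x′ → x + + N ≤ x′ →
      ¬ SemistandardFilling n k lam d mu
    long-row⇒¬SemistandardFilling i x x′ (lo<x , _) (_ , x′≤hi) x+N≤x′ (F , F∈ , ss) =
      tall-column⇒¬semistandard i x lo<x (ℤP.≤-trans x+N≤x′ x′≤hi) F∈ ss

    apart-in-row⇒¬SemistandardFilling : ∀ i j y c → Cell i j → Cell i y → j - y ≡ c * + N → j ≢ y →
      ¬ SemistandardFilling n k lam d mu
    apart-in-row⇒¬SemistandardFilling i j y c ij∈D iy∈D j-y≡ j≢y with congruent-distinct⇒apart c N j-y≡ j≢y
    ... | inj₁ y+N≤j = long-row⇒¬SemistandardFilling i y j iy∈D ij∈D y+N≤j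
    ... | inj₂ j+N≤y = long-row⇒¬SemistandardFilling i j y ij∈D iy∈D j+N≤y

    nonzero⇒IsToric : ToricSchurNonzero n k lam d mu → IsToric n k lam d mu
    nonzero⇒IsToric nonzero i j i′ j′ ij∈D i′j′∈D k∣i-i′ N∣j-j′
      with ℤD.∣ᵤ⇒∣ {+ k} {i - i′} k∣i-i′ | ℤD.∣ᵤ⇒∣ {+ N} {j - j′} N∣j-j′
    ... | ℤD.divides q i-i′≡ | ℤD.divides c j-j′≡ with j′ ℤ.≟ j + q * + N
    ... | yes j′≡ = q , trans (i′≡i-[i-i′] i i′) (cong (_-_ i) i-i′≡) , j′≡
      where
      i′≡i-[i-i′] : ∀ i i′ → i′ ≡ i - (i - i′)
      i′≡i-[i-i′] = solve-∀
    ... | no j′≢ = ⊥-elim (nonzero (¬SemistandardFilling⇒coeff≡0 n k lam d mu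
                     (apart-in-row⇒¬SemistandardFilling i j y (c + q) ij∈D iy∈D j-y≡ j≢y)))
      where
      i≡i′+[i-i′] : ∀ i i′ → i ≡ i′ + (i - i′)
      i≡i′+[i-i′] = solve-∀
      regroup : ∀ j j′ q nn → j - (j′ - q * nn) ≡ (j - j′) + q * nn
      regroup = solve-∀
      distrib : ∀ c q nn → c * nn + q * nn ≡ (c + q) * nn
      distrib = solve-∀
      j′≡[j′-qN]+qN : ∀ j′ q nn → j′ ≡ (j′ - q * nn) + q * nn
      j′≡[j′-qN]+qN = solve-∀
      y = j′ - q * + N
      iy∈D : Cell i y
      iy∈D = Cell-translate q {i′} {j′} (trans (i≡i′+[i-i′] i i′) (cong (_+_ i′) i-i′≡)) refl i′j′∈D
      j-y≡ : j - y ≡ (c + q) * + N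
      j-y≡ = trans (regroup j j′ q (+ N)) (trans (cong (_+ q * + N) j-j′≡) (distrib c q (+ N)))
      j≢y : j ≢ y
      j≢y j≡y = j′≢ (trans (j′≡[j′-qN]+qN j′ q (+ N)) (cong (_+ q * + N) (sym j≡y)))

  -- Toric shapes

  module ToricTableau (n k : ℕ) {{_ : NonZero k}} (k<n : k ℕ.< n) (lam mu : Fin k → ℕ) (ipL : InP n k lam) (d : ℕ)
                      (toric : IsToric n k lam d mu) where
    open SemistandardTest n k lam d mu
    open Equivalence

    lo<-translate : ∀ q {i j} → lo i < j ⇔ lo (i + q * + k) < j - q * + N
    lo<-translate q {i} {j} = mk⇔
      (λ lo<j → subst (_< j - q * + N) (sym lo[i+qk]) (ℤP.+-monoˡ-< (- (q * + N)) lo<j))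
      (λ lo<j → subst₂ _<_ (cancel (lo i) (q * + N)) (cancel j (q * + N))
                  (ℤP.+-monoˡ-< (q * + N) (subst (_< j - q * + N) lo[i+qk] lo<j)))
      where
      lo[i+qk] : lo (i + q * + k) ≡ lo i - q * + N
      lo[i+qk] = shiftSeq-periodic mu 0ℤ i q
      cancel : ∀ a b → (a - b) + b ≡ a
      cancel = solve-∀

    startsBefore : ℤ → ℤ → ℕ
    startsBefore i j with lo i ℤ.<? j
    ... | yes _ = 1
    ... | no _ = 0

    startsBefore-yes : ∀ {i j} → lo i < j → startsBefore i j ≡ 1
    startsBefore-yes {i} {j} lo<j with lo i ℤ.<? j
    ... | yes _ = refl
    ... | no lo≮j = ⊥-elim (lo≮j lo<j)

    startsBefore-no : ∀ {i j} → ¬ lo i < j → startsBefore i j ≡ 0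
    startsBefore-no {i} {j} lo≮j with lo i ℤ.<? j
    ... | yes lo<j = ⊥-elim (lo≮j lo<j)
    ... | no _ = refl

    startsBefore≤1 : ∀ i j → startsBefore i j ℕ.≤ 1
    startsBefore≤1 i j with lo i ℤ.<? j
    ... | yes _ = ℕP.≤-refl
    ... | no _ = ℕ.z≤n

    startsBefore-mono : ∀ i {j j′} → j ≤ j′ → startsBefore i j ℕ.≤ startsBefore i j′
    startsBefore-mono i {j} {j′} j≤j′ with lo i ℤ.<? j | lo i ℤ.<? j′
    ... | yes _ | yes _ = ℕP.≤-refl
    ... | yes lo<j | no lo≮j′ = ⊥-elim (lo≮j′ (ℤP.<-≤-trans lo<j j≤j′))
    ... | no _ | _ = ℕ.z≤n

    startsBefore-translate : ∀ q {i j i′ j′} → i′ ≡ i + q * + k → j′ ≡ j - q * + N →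
      startsBefore i′ j′ ≡ startsBefore i j
    startsBefore-translate q {i} {j} refl refl with lo (i + q * + k) ℤ.<? j - q * + N | lo i ℤ.<? j
    ... | yes _ | yes _ = refl
    ... | no _ | no _ = refl
    ... | yes lo′<j′ | no lo≮j = ⊥-elim (lo≮j (from (lo<-translate q {i} {j}) lo′<j′))
    ... | no lo′≮j′ | yes lo<j = ⊥-elim (lo′≮j′ (to (lo<-translate q {i} {j}) lo<j))

    countAbove : ℤ → ℤ → ℕ → ℕ
    countAbove i j zero = 0
    countAbove i j (suc m) = startsBefore (i - 1ℤ) j ℕ.+ countAbove (i - 1ℤ) j m

    countAbove≤ : ∀ i j m → countAbove i j m ℕ.≤ m
    countAbove≤ i j zero = ℕ.z≤n
    countAbove≤ i j (suc m) = ℕP.+-mono-≤ (startsBefore≤1 (i - 1ℤ) j) (countAbove≤ (i - 1ℤ) j m)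

    countAbove-mono : ∀ i {j j′} m → j ≤ j′ → countAbove i j m ℕ.≤ countAbove i j′ m
    countAbove-mono i zero j≤j′ = ℕ.z≤n
    countAbove-mono i (suc m) j≤j′ = ℕP.+-mono-≤ (startsBefore-mono (i - 1ℤ) j≤j′) (countAbove-mono (i - 1ℤ) m j≤j′)

    countAbove-translate : ∀ q {i j i′ j′} m → i′ ≡ i + q * + k → j′ ≡ j - q * + N →
      countAbove i′ j′ m ≡ countAbove i j m
    countAbove-translate q zero _ _ = refl
    countAbove-translate q {i} (suc m) refl j′≡ =
      cong₂ ℕ._+_ (startsBefore-translate q (shift i q (+ k)) j′≡) (countAbove-translate q m (shift i q (+ k)) j′≡)
      where
      shift : ∀ i q kk → (i + q * kk) - 1ℤ ≡ (i - 1ℤ) + q * kk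
      shift = solve-∀

    countAbove-suc : ∀ i j m → countAbove i j (suc m) ≡ countAbove i j m ℕ.+ startsBefore (i - + suc m) j
    countAbove-suc i j zero = ℕP.+-comm (startsBefore (i - 1ℤ) j) 0
    countAbove-suc i j (suc m) = begin
      startsBefore (i - 1ℤ) j ℕ.+ countAbove (i - 1ℤ) j (suc m)
        ≡⟨ cong (startsBefore (i - 1ℤ) j ℕ.+_) (countAbove-suc (i - 1ℤ) j m) ⟩
      startsBefore (i - 1ℤ) j ℕ.+ (countAbove (i - 1ℤ) j m ℕ.+ startsBefore ((i - 1ℤ) - + suc m) j)
        ≡⟨ ℕP.+-assoc (startsBefore (i - 1ℤ) j) _ _ ⟨
      countAbove i j (suc m) ℕ.+ startsBefore ((i - 1ℤ) - + suc m) j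
        ≡⟨ cong (λ r → countAbove i j (suc m) ℕ.+ startsBefore r j) (assoc i (+ m)) ⟩
      countAbove i j (suc m) ℕ.+ startsBefore (i - + suc (suc m)) j ∎
      where
      open ≡-Reasoning
      assoc : ∀ i m → (i - 1ℤ) - (1ℤ + m) ≡ i - (1ℤ + (1ℤ + m))
      assoc = solve-∀

    countAbove-next-row : ∀ i j m → lo i < j → countAbove (i + 1ℤ) j (suc m) ≡ suc (countAbove i j m)
    countAbove-next-row i j m lo<j =
      subst (λ r → startsBefore r j ℕ.+ countAbove r j m ≡ suc (countAbove i j m)) (sym (cancel i))
        (cong (ℕ._+ countAbove i j m) (startsBefore-yes lo<j))
      where
      cancel : ∀ i → (i + 1ℤ) - 1ℤ ≡ i
      cancel = solve-∀

    -- (r - k , j) and (r , j) have the same image in ℤ/k × ℤ/(n-k) but lie in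
    -- different classes, so toricity keeps (r - k , j) out of D.
    toric⇒¬lo[r-k]<j : ∀ r j → Cell r j → ¬ lo (r - + k) < j
    toric⇒¬lo[r-k]<j r j rj∈D@(_ , j≤hi) lo<j
      with toric (r - + k) j r j (lo<j , j≤hi[r-k]) rj∈D k∣ N∣
      where
      j≤hi[r-k] : j ≤ hi (r - + k)
      j≤hi[r-k] = ℤP.≤-trans j≤hi (shiftSeq-antitone lam ipL (+ d) (ℤP.i≤j⇒i-k≤j (+ k) (ℤP.≤-refl {r})))
      diff-k : ∀ r kk → (r - kk) - r ≡ (- 1ℤ) * kk
      diff-k = solve-∀
      diff-0 : ∀ j nn → j - j ≡ 0ℤ * nn
      diff-0 = solve-∀
      k∣ : + k ∣ (r - + k) - r
      k∣ = ℤD.∣⇒∣ᵤ (ℤD.divides (- 1ℤ) (diff-k r (+ k)))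
      N∣ : + N ∣ j - j
      N∣ = ℤD.∣⇒∣ᵤ {+ N} {j - j} (ℤD.divides 0ℤ (diff-0 j (+ N)))
    ... | q , r≡ , j≡ = [ q≢0 , N≢0 ]′ (ℤP.i*j≡0⇒i≡0∨j≡0 q qN≡0)
      where
      j+x-j : ∀ j x → x ≡ (j + x) - j
      j+x-j = solve-∀
      qN≡0 : q * + N ≡ 0ℤ
      qN≡0 = trans (j+x-j j (q * + N)) (trans (cong (_- j) (sym j≡)) (ℤP.+-inverseʳ j))
      N≢0 : + N ≢ 0ℤ
      N≢0 N≡0 = ℕP.<⇒≢ (ℕP.m<n⇒0<n∸m k<n) (sym (ℤP.+-injective N≡0))
      k≡ : ∀ r kk → kk ≡ r - ((r - kk) - 0ℤ * kk)
      k≡ = solve-∀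
      q≢0 : q ≢ 0ℤ
      q≢0 q≡0 = ℕ.≢-nonZero⁻¹ k (ℤP.+-injective (trans (k≡ r (+ k))
        (trans (cong (_-_ r) (sym (subst (λ x → r ≡ (r - + k) - x * + k) q≡0 r≡))) (ℤP.+-inverseʳ r))))

    countAbove-strict : ∀ {i j} → Cell i j → Cell (i + 1ℤ) j →
      countAbove i j (ℕ.pred k) ℕ.< countAbove (i + 1ℤ) j (ℕ.pred k)
    countAbove-strict {i} {j} (lo<j , _) i+1j∈D = go (ℕ.pred k) (ℕP.suc-pred k)
      where
      gap = toric⇒¬lo[r-k]<j (i + 1ℤ) j i+1j∈D
      i≡ : ∀ i → i ≡ (i + 1ℤ) - 1ℤ
      i≡ = solve-∀
      i-m-1≡ : ∀ i m → i - (1ℤ + m) ≡ (i + 1ℤ) - (1ℤ + (1ℤ + m))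
      i-m-1≡ = solve-∀
      go : ∀ m → suc m ≡ k → countAbove i j m ℕ.< countAbove (i + 1ℤ) j m
      go zero 1≡k = ⊥-elim (gap (subst (λ r → lo r < j) (subst (λ x → i ≡ (i + 1ℤ) - + x) 1≡k (i≡ i)) lo<j))
      go (suc m) m+2≡k = subst₂ ℕ._<_ (sym last≡0) (sym (countAbove-next-row i j m lo<j)) ℕP.≤-refl
        where
        last≡0 : countAbove i j (suc m) ≡ countAbove i j m
        last≡0 = trans (countAbove-suc i j m) (trans
          (cong (countAbove i j m ℕ.+_) (startsBefore-no (subst (λ r → ¬ lo r < j)
            (sym (subst (λ x → i - + suc m ≡ (i + 1ℤ) - + x) m+2≡k (i-m-1≡ i (+ m)))) gap)))
          (ℕP.+-identityʳ _))

    countAbove<k : ∀ i j → countAbove i j (ℕ.pred k) ℕ.< k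
    countAbove<k i j = subst (countAbove i j (ℕ.pred k) ℕ.<_) (ℕP.suc-pred k) (ℕ.s≤s (countAbove≤ i j (ℕ.pred k)))

    tableauRow : ℕ → List (Fin k)
    tableauRow s = map (λ t → fromℕ< (countAbove<k (+ suc s) (lo (+ suc s) + 1ℤ + + t))) (upTo (len (+ suc s)))

    tableau : Filling k
    tableau = map tableauRow (upTo k)

    tableau∈allFillings : tableau ∈ allFillings n k lam d mu
    tableau∈allFillings = subst (λ ls → tableau ∈ fillingsOf k ls) shape (∈-fillingsOf tableau)
      where
      open ≡-Reasoning
      shape : map length tableau ≡ map len (repRows k)
      shape = begin
        map length (map tableauRow (upTo k))   ≡⟨ ListP.map-∘ (upTo k) ⟨
        map (length ∘ tableauRow) (upTo k)     ≡⟨ ListP.map-cong (λ s → trans (ListP.length-map _ (upTo (len (+ suc s))))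
                                                                              (ListP.length-upTo _)) (upTo k) ⟩
        map (len ∘ (λ s → + suc s)) (upTo k)   ≡⟨ ListP.map-∘ (upTo k) ⟩
        map len (repRows k)                    ∎

    entry-tableau : ∀ {i j} → Cell i j → entry n k mu tableau i j ≡ suc (countAbove i j (ℕ.pred k))
    entry-tableau {i} {j} ij∈D = begin
      entry n k mu tableau i j                    ≡⟨ entry-representative tableau r ⟩
      entryInRow (nth tableau row) (+ offset)     ≡⟨ cong (λ x → entryInRow x (+ offset)) (nth-map-upTo tableauRow row<k) ⟩
      entryInRow (just (tableauRow row)) (+ offset) ≡⟨ entryInRow-just (tableauRow row) (nth-map-upTo _ offset<len) ⟩
      suc (toℕ (fromℕ< (countAbove<k i′ j′)))     ≡⟨ cong suc (FinP.toℕ-fromℕ< _) ⟩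
      suc (countAbove i′ j′ (ℕ.pred k))           ≡⟨ cong suc (countAbove-translate (- shift) (ℕ.pred k) i′≡ j′≡) ⟩
      suc (countAbove i j (ℕ.pred k))             ∎
      where
      open ≡-Reasoning
      r = representative {i} {j} ij∈D
      open Representative r
      i′ = + suc row
      j′ = lo i′ + 1ℤ + + offset
      i′≡ : i′ ≡ i + (- shift) * + k
      i′≡ = i-1≡s+qk⇒1+s≡i-qk {i} {+ row} shift (+ k) row≡
      j′≡ : j′ ≡ j - (- shift) * + N
      j′≡ = trans (sym col≡) (j+qn≡j-[-q]n j shift (+ N))

    tableau-semistandard : Semistandard tableau
    tableau-semistandard {i} {j} ij∈D =
      (λ ij+1∈D → subst₂ ℕ._≤_ (sym (entry-tableau ij∈D)) (sym (entry-tableau {i} {j + 1ℤ} ij+1∈D))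
         (ℕ.s≤s (countAbove-mono i (ℕ.pred k) (ℤP.i≤i+j j 1ℤ)))) ,
      (λ i+1j∈D → subst₂ ℕ._<_ (sym (entry-tableau ij∈D)) (sym (entry-tableau {i + 1ℤ} {j} i+1j∈D))
         (ℕ.s≤s (countAbove-strict ij∈D i+1j∈D)))

    toric⇒SemistandardFilling : SemistandardFilling n k lam d mu
    toric⇒SemistandardFilling = tableau , tableau∈allFillings , Semistandard⇒semistandardᵇ tableau tableau-semistandard

open CylindricTableaux
open import Data.Nat using (ℕ; NonZero; _<_)
open import Data.Fin using (Fin)
open import Function.Base using (_∘_)
open import Function.Bundles using (_⇔_; mk⇔)

lemma6p2 : (n k : ℕ) {{_ : NonZero k}} → k < n →
    (lam mu : Fin k → ℕ) → InP n k lam → InP n k mu → (d : ℕ) →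
    ToricSchurNonzero n k lam d mu ⇔ IsToric n k lam d mu
lemma6p2 n k k<n lam mu ipL ipM d = mk⇔
  (NonToric.nonzero⇒IsToric n k lam mu ipL ipM d)
  (SemistandardFilling⇒nonzero n k lam d mu ∘ ToricTableau.toric⇒SemistandardFilling n k k<n lam mu ipL d)
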